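{- In any implicative structure $\mathscr{A}$, $\textsc{Ind}^{\mathscr{A}}\dashv\vdash_{S^0_J(\mathscr{A})}{\pitchfork}^{\mathscr{A}}$, i.e. both $(\textsc{Ind}^{\mathscr{A}}\to{\pitchfork}^{\mathscr{A}})$ and $({\pitchfork}^{\mathscr{A}}\to\textsc{Ind}^{\mathscr{A}})$ belong to the intuitionistic core $S^0_J(\mathscr{A})$.
   Context: An implicative structure is a complete lattice $(\mathscr{A},\preccurlyeq)$ (meets $\bigwedge$, binary meet $\wedge$) with $\to$ anti-monotonic in its first and monotonic in its second argument, commuting with arbitrary meets in its second argument. A separator is an upwards closed subset containing $(\lambda xy.x)^{\mathscr{A}}=\bigwedge_{a,b}(a\to b\to a)$ and $(\lambda xyz.xz(yz))^{\mathscr{A}}=\bigwedge_{a,b,c}((a\to b\to c)\to(a\to b)\to a\to c)$ and closed under modus ponens. The intuitionistic core $S^0_J(\mathscr{A})$ is the smallest separator of $\mathscr{A}$. ${\pitchfork}^{\mathscr{A}}=\bigwedge_{a,b\in\mathscr{A}}(a\to b\to a\wedge b)$. For $n\in\omega$, $\mathsf{N}^{\mathscr{A}}(n)=\bigwedge_{a\in\mathscr{A}^{\omega}}\bigl(a_0\to\bigwedge_{i\in\omega}(a_i\to a_{i+1})\to a_n\bigr)$, and $\textsc{Ind}^{\mathscr{A}}=\bigwedge_{n\in\omega}\mathsf{N}^{\mathscr{A}}(n)$ interprets the unrelativized induction principle. -}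

module Defs where

open import Level using (Level; Lift; lift; _⊔_) renaming (suc to lsuc)
open import Data.Nat using (ℕ; suc)
open import Data.Bool using (Bool; true; false)
open import Data.Product using (_×_; _,_)
open import Relation.Binary.PropositionalEquality using (_≡_)

record ImplicativeStructure (ℓ : Level) : Set (lsuc ℓ) where
  infixr 5 _⇒_
  infix 4 _≼_
  field
    Carrier : Set ℓ
    _≼_ : Carrier → Carrier → Set ℓ
    ≼-refl : ∀ {a} → a ≼ a
    ≼-trans : ∀ {a b c} → a ≼ b → b ≼ c → a ≼ c
    ≼-antisym : ∀ {a b} → a ≼ b → b ≼ a → a ≡ b
    ⋀ : {I : Set ℓ} → (I → Carrier) → Carrier
    ⋀-lb : ∀ {I : Set ℓ} (f : I → Carrier) (i : I) → ⋀ f ≼ f i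
    ⋀-glb : ∀ {I : Set ℓ} (f : I → Carrier) (c : Carrier) →
            (∀ i → c ≼ f i) → c ≼ ⋀ f
    _⇒_ : Carrier → Carrier → Carrier
    ⇒-mono : ∀ {a a' b b'} → a' ≼ a → b ≼ b' → (a ⇒ b) ≼ (a' ⇒ b')
    ⇒-⋀ : ∀ (a : Carrier) {I : Set ℓ} (f : I → Carrier) →
          (a ⇒ ⋀ f) ≡ ⋀ (λ i → a ⇒ f i)

  infixr 6 _∧_
  _∧_ : Carrier → Carrier → Carrier
  a ∧ b = ⋀ {Lift ℓ Bool} (λ { (lift true) → a ; (lift false) → b })

  𝐊 : Carrier
  𝐊 = ⋀ {Carrier × Carrier} (λ { (a , b) → a ⇒ b ⇒ a })

  𝐒 : Carrier
  𝐒 = ⋀ {Carrier × Carrier × Carrier}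
        (λ { (a , b , c) → (a ⇒ b ⇒ c) ⇒ (a ⇒ b) ⇒ a ⇒ c })

  record IsSeparator (S : Carrier → Set ℓ) : Set ℓ where
    field
      upward : ∀ {a b} → S a → a ≼ b → S b
      K∈S : S 𝐊
      S∈S : S 𝐒
      mp : ∀ {a b} → S (a ⇒ b) → S a → S b

  -- intuitionistic core S⁰_J(A): the smallest separator, i.e. the
  -- intersection of all separators
  S⁰J : Carrier → Set (lsuc ℓ)
  S⁰J a = (S : Carrier → Set ℓ) → IsSeparator S → S a

  ⋔ : Carrier
  ⋔ = ⋀ {Carrier × Carrier} (λ { (a , b) → a ⇒ b ⇒ a ∧ b })

  𝐍 : ℕ → Carrier
  𝐍 n = ⋀ {ℕ → Carrier}
          (λ a → a 0 ⇒ ⋀ {Lift ℓ ℕ} (λ { (lift i) → a i ⇒ a (suc i) }) ⇒ a n)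

  Ind : Carrier
  Ind = ⋀ {Lift ℓ ℕ} (λ { (lift n) → 𝐍 n })

module Submission where

-- Both directions are proved by exhibiting closed combinatory terms that
-- realize them; every closed term built from K and S denotes an element of
-- every separator, hence of the intuitionistic core S⁰J.

open import Defs
open import Level using (Level; Lift; lift)
open import Data.Product using (_×_; _,_; Σ; proj₁; proj₂)
open import Data.Nat using (ℕ; zero; suc)
open import Data.Bool using (true; false)
open import Data.Maybe using (Maybe; just; nothing)
open import Data.Empty using (⊥)
open import Relation.Binary.PropositionalEquality using (subst; sym)

-- SK-terms over a set V of free variables; variables of Maybe V are V
-- together with one fresh variable (nothing), de Bruijn style.
data Tm (V : Set) : Set where
  var : V → Tm V
  k s : Tm V
  _∙_ : Tm V → Tm V → Tm V
infixl 7 _∙_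

v₀ : ∀ {V : Set} → Tm (Maybe V)
v₀ = var nothing

v₁ : ∀ {V : Set} → Tm (Maybe (Maybe V))
v₁ = var (just nothing)

v₂ : ∀ {V : Set} → Tm (Maybe (Maybe (Maybe V)))
v₂ = var (just (just nothing))

v₃ : ∀ {V : Set} → Tm (Maybe (Maybe (Maybe (Maybe V))))
v₃ = var (just (just (just nothing)))

lam : ∀ {V : Set} → Tm (Maybe V) → Tm V
lam (var nothing)  = s ∙ k ∙ k
lam (var (just x)) = k ∙ var x
lam k              = k ∙ k
lam s              = k ∙ s
lam (t ∙ u)        = s ∙ lam t ∙ lam u

-- Turing's fixpoint combinator Θ = A A with A = λx f. f (x x f).
turing-body : ∀ {V : Set} → Tm (Maybe (Maybe V))
turing-body = v₀ ∙ (v₁ ∙ v₁ ∙ v₀)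

turing-A : ∀ {V : Set} → Tm V
turing-A = lam (lam turing-body)

Θ : ∀ {V : Set} → Tm V
Θ = turing-A ∙ turing-A

module _ {ℓ : Level} (𝒜 : ImplicativeStructure ℓ) where
  open ImplicativeStructure 𝒜

  _⟫_ : ∀ {a b c} → a ≼ b → b ≼ c → a ≼ c
  _⟫_ = ≼-trans
  infixr 4 _⟫_

  -- Application: the least c with a ≼ b ⇒ c (it exists since ⇒ commutes
  -- with meets in its second argument).
  infixl 7 _·_
  _·_ : Carrier → Carrier → Carrier
  a · b = ⋀ {Σ Carrier (λ c → a ≼ (b ⇒ c))} proj₁

  app-ub : ∀ {a b} → a ≼ (b ⇒ a · b)
  app-ub {a} {b} =
    subst (a ≼_) (sym (⇒-⋀ b proj₁)) (⋀-glb _ a proj₂)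

  app-le : ∀ {a b c} → a ≼ (b ⇒ c) → a · b ≼ c
  app-le {c = c} h = ⋀-lb proj₁ (c , h)

  adj : ∀ {a b c} → a · b ≼ c → a ≼ (b ⇒ c)
  adj h = app-ub ⟫ ⇒-mono ≼-refl h

  app-≼ : ∀ {a u x z} → a ≼ (x ⇒ z) → u ≼ x → a · u ≼ z
  app-≼ h hu = app-le (h ⟫ ⇒-mono hu ≼-refl)

  ·-mono : ∀ {a a' b b'} → a ≼ a' → b ≼ b' → a · b ≼ a' · b'
  ·-mono ha hb = app-≼ (ha ⟫ app-ub) hb

  K-red : ∀ {x y} → 𝐊 · x · y ≼ x
  K-red {x} {y} = app-≼ (app-≼ (⋀-lb _ (x , y)) ≼-refl) ≼-refl

  S-red : ∀ {x y z} → 𝐒 · x · y · z ≼ (x · z) · (y · z)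
  S-red {x} {y} {z} =
    app-≼ (app-≼ (app-≼ (⋀-lb _ (z , y · z , (x · z) · (y · z)))
                         (app-ub ⟫ ⇒-mono ≼-refl app-ub))
                 app-ub)
          ≼-refl

  eval : ∀ {V : Set} → (V → Carrier) → Tm V → Carrier
  eval ρ (var x) = ρ x
  eval ρ k       = 𝐊
  eval ρ s       = 𝐒
  eval ρ (t ∙ u) = eval ρ t · eval ρ u

  ext : ∀ {V : Set} → (V → Carrier) → Carrier → Maybe V → Carrier
  ext ρ v nothing  = v
  ext ρ v (just x) = ρ x

  beta : ∀ {V : Set} (ρ : V → Carrier) (t : Tm (Maybe V)) v →
         eval ρ (lam t) · v ≼ eval (ext ρ v) t
  beta ρ (var nothing)  v = S-red ⟫ K-red
  beta ρ (var (just x)) v = K-red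
  beta ρ k              v = K-red
  beta ρ s              v = K-red
  beta ρ (t ∙ u)        v = S-red ⟫ ·-mono (beta ρ t v) (beta ρ u v)

  lam-≼ : ∀ {V : Set} (ρ : V → Carrier) (t : Tm (Maybe V)) {a b} →
          eval (ext ρ a) t ≼ b → eval ρ (lam t) ≼ (a ⇒ b)
  lam-≼ ρ t h = adj (beta ρ t _ ⟫ h)

  Θ-unfold : ∀ {V : Set} (ρ : V → Carrier) g → eval ρ Θ · g ≼ g · (eval ρ Θ · g)
  Θ-unfold ρ g =
    ·-mono (beta ρ (lam turing-body) a) ≼-refl ⟫ beta (ext ρ a) turing-body g
    where
    a : Carrier
    a = eval ρ turing-A

  fix-unfold : ∀ {V : Set} (ρ : V → Carrier) (t : Tm (Maybe V)) →
               eval ρ (Θ ∙ lam t) ≼ eval (ext ρ (eval ρ (Θ ∙ lam t))) t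
  fix-unfold ρ t = Θ-unfold ρ (eval ρ (lam t)) ⟫ beta ρ t _

  eval∈S : ∀ {S} → IsSeparator S → ∀ {V : Set} (ρ : V → Carrier) →
           (∀ x → S (ρ x)) → ∀ t → S (eval ρ t)
  eval∈S sep ρ h (var x) = h x
  eval∈S sep ρ h k       = IsSeparator.K∈S sep
  eval∈S sep ρ h s       = IsSeparator.S∈S sep
  eval∈S sep ρ h (t ∙ u) =
    IsSeparator.mp sep (IsSeparator.upward sep (eval∈S sep ρ h t) app-ub)
                       (eval∈S sep ρ h u)

  ρ₀ : ⊥ → Carrier
  ρ₀ ()

  S⁰J-closed : (t : Tm ⊥) {X : Carrier} → eval ρ₀ t ≼ X → S⁰J X
  S⁰J-closed t h S sep = IsSeparator.upward sep (eval∈S sep ρ₀ (λ ()) t) h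

  ∧-glb : ∀ {x a b} → x ≼ a → x ≼ b → x ≼ a ∧ b
  ∧-glb ha hb = ⋀-glb _ _ λ { (lift true) → ha ; (lift false) → hb }

  ∧-lb₁ : ∀ {a b} → a ∧ b ≼ a
  ∧-lb₁ = ⋀-lb _ (lift true)

  ∧-lb₂ : ∀ {a b} → a ∧ b ≼ b
  ∧-lb₂ = ⋀-lb _ (lift false)

  ⋔-pair : ∀ {u v} → ⋔ · u · v ≼ u ∧ v
  ⋔-pair {u} {v} = app-≼ (app-≼ (⋀-lb _ (u , v)) ≼-refl) ≼-refl

  steps : (ℕ → Carrier) → Carrier
  steps c = ⋀ {Lift ℓ ℕ} (λ { (lift i) → c i ⇒ c (suc i) })

  Ind-elim : ∀ (c : ℕ → Carrier) m {u v} → u ≼ c 0 → v ≼ steps c →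
             Ind · u · v ≼ c m
  Ind-elim c m hu hv = app-≼ (app-≼ (⋀-lb _ (lift m) ⟫ ⋀-lb _ c) hu) hv

  Ind-pairs : ∀ a b → Ind · a · (𝐊 · b) ≼ a ∧ b
  Ind-pairs a b = ∧-glb (Ind-elim c 0 ≼-refl Kb) (Ind-elim c 1 ≼-refl Kb)
    where
    c : ℕ → Carrier
    c zero    = a
    c (suc _) = b
    Kb : 𝐊 · b ≼ steps c
    Kb = ⋀-glb _ _ λ { (lift i) → adj K-red }

  fixpoint-below : ∀ (c : ℕ → Carrier) {x a f} →
                   x ≼ ⋔ · a · (f · x) → a ≼ c 0 → f ≼ steps c →
                   ∀ n → x ≼ c n
  fixpoint-below c hx ha hf zero    = hx ⟫ ⋔-pair ⟫ ∧-lb₁ ⟫ ha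
  fixpoint-below c hx ha hf (suc n) =
    hx ⟫ ⋔-pair ⟫ ∧-lb₂ ⟫
    app-≼ (hf ⟫ ⋀-lb _ (lift n)) (fixpoint-below c hx ha hf n)

  -- First direction, realized by λn a b. n a (K b).
  Ind⇒⋔ : S⁰J (Ind ⇒ ⋔)
  Ind⇒⋔ = S⁰J-closed (lam (lam (lam body)))
    (lam-≼ ρ₀ (lam (lam body)) (⋀-glb _ _ λ { (a , b) →
       lam-≼ (ext ρ₀ Ind) (lam body) (lam-≼ (ext (ext ρ₀ Ind) a) body (Ind-pairs a b)) }))
    where
    body : Tm (Maybe (Maybe (Maybe ⊥)))
    body = v₂ ∙ v₁ ∙ (k ∙ v₀)

  -- Second direction, realized by λp a f. Θ (λr. p a (f r)); the body
  -- evaluated at p = ⋔, a = c 0, f = steps c is a solution of x ≼ ⋔ a (f x).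
  ⋔⇒Ind : S⁰J (⋔ ⇒ Ind)
  ⋔⇒Ind = S⁰J-closed (lam (lam (lam body)))
    (lam-≼ ρ₀ (lam (lam body)) (⋀-glb _ _ λ { (lift n) → ⋀-glb _ _ λ c →
       lam-≼ (ext ρ₀ ⋔) (lam body) (lam-≼ (ext (ext ρ₀ ⋔) (c 0)) body
         (fixpoint-below c (fix-unfold (ρ c) recursor) ≼-refl ≼-refl n)) }))
    where
    recursor : Tm (Maybe (Maybe (Maybe (Maybe ⊥))))
    recursor = v₃ ∙ v₂ ∙ (v₁ ∙ v₀)
    body : Tm (Maybe (Maybe (Maybe ⊥)))
    body = Θ ∙ lam recursor
    ρ : (ℕ → Carrier) → Maybe (Maybe (Maybe ⊥)) → Carrier
    ρ c = ext (ext (ext ρ₀ ⋔) (c 0)) (steps c)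

proposition3p28 : {ℓ : Level} (𝒜 : ImplicativeStructure ℓ) →
    let open ImplicativeStructure 𝒜 in
    S⁰J (Ind ⇒ ⋔) × S⁰J (⋔ ⇒ Ind)
proposition3p28 𝒜 = Ind⇒⋔ 𝒜 , ⋔⇒Ind 𝒜
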